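{- For the $n$-sided antiprism graph $A_n$ on $2n$ vertices ($n\ge3$), with its standard plane embedding, $\pi_{fl}(A_n)\le 7$.
   Context: The $n$-sided antiprism graph $A_n$ has vertices $v_1,\dots,v_n,u_1,\dots,u_n$ and $4n$ edges: the two $n$-cycles $v_1\dots v_n$ and $u_1\dots u_n$, together with edges $u_1v_1,u_1v_n$ and $u_iv_i,u_iv_{i-1}$ for $i=2,\dots,n$; its standard plane embedding has two $n$-gonal faces (bounded by the two cycles) and $2n$ triangular faces. A sequence $r_1\dots r_{2n}$ is a repetition if $r_i=r_{n+i}$ for all $i\le n$. In a plane graph $G$, a facial path is a path whose vertices and edges are consecutive on the boundary walk of some face of $G$. A vertex colouring is facial non-repetitive if no facial path on vertices $v_1,\dots,v_{2n}$ ($n\ge1$) has colour sequence that is a repetition. $\pi_{fl}(G)$ is the minimum $l$ such that for every assignment of lists $L(v)\subseteq\mathbb{Z}_+$ with $|L(v)|\ge l$ there is a facial non-repetitive colouring $\varphi$ with $\varphi(v)\in L(v)$ for every vertex $v$. -}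

module Defs where

open import Data.Nat using (ℕ; zero; suc; _+_; _*_; _∸_; _≤_; _<_; NonZero)
open import Data.Nat.DivMod using (_%_; m%n<n)
open import Data.Fin using (Fin; toℕ; fromℕ<)
open import Data.Sum using (_⊎_; inj₁; inj₂)
open import Data.Bool using (Bool; true; false)
open import Data.Vec using (Vec; lookup; _∷_; [])
open import Data.List using (List; length)
open import Data.List.Relation.Unary.Unique.Propositional using (Unique)
open import Data.List.Membership.Propositional using (_∈_)
open import Data.Product using (∃; _×_)
open import Relation.Binary.PropositionalEquality using (_≡_)
open import Relation.Nullary using (¬_)

-- Vertices of the antiprism A_n (0-indexed): inj₁ i = v_{i+1}, inj₂ i = u_{i+1}.
Vertex : ℕ → Set
Vertex n = Fin n ⊎ Fin n

idx : (n : ℕ) → .{{_ : NonZero n}} → ℕ → Fin n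
idx n j = fromℕ< (m%n<n j n)

module _ {n : ℕ} .{{_ : NonZero n}} where

  vv uu : ℕ → Vertex n
  vv j = inj₁ (idx n j)
  uu j = inj₂ (idx n j)

  -- Faces of the standard plane embedding of A_n:
  --   cycV : the n-gon bounded by v_1 … v_n
  --   cycU : the n-gon bounded by u_1 … u_n
  --   triA i : triangle (u_i, v_i, v_{i-1})
  --   triB i : triangle (v_i, u_i, u_{i+1})
  data Face : Set where
    cycV cycU : Face
    triA triB : Fin n → Face

  faceLen : Face → ℕ
  faceLen cycV = n
  faceLen cycU = n
  faceLen (triA _) = 3
  faceLen (triB _) = 3

  tri : Vertex n → Vertex n → Vertex n → ℕ → Vertex n
  tri a b c j = lookup (a ∷ b ∷ c ∷ []) (idx 3 j)

  faceVertex : Face → ℕ → Vertex n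
  faceVertex cycV j = vv j
  faceVertex cycU j = uu j
  faceVertex (triA i) = tri (uu (toℕ i)) (vv (toℕ i)) (vv (toℕ i + (n ∸ 1)))
  faceVertex (triB i) = tri (vv (toℕ i)) (uu (toℕ i)) (uu (suc (toℕ i)))

  -- consecutive traversal of the boundary walk of f, starting at position s,
  -- forwards (true) or backwards (false; step k-1 ≡ -1 mod k)
  faceWalk : Face → ℕ → Bool → ℕ → Vertex n
  faceWalk f s true j = faceVertex f (s + j)
  faceWalk f s false j = faceVertex f (s + (faceLen f ∸ 1) * j)

  IsPath : (ℕ → Vertex n) → ℕ → Set
  IsPath w len = ∀ i j → i < len → j < len → w i ≡ w j → i ≡ j

  Repetition : (Vertex n → ℕ) → (ℕ → Vertex n) → ℕ → Set
  Repetition φ w m = ∀ j → j < m → φ (w j) ≡ φ (w (m + j))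

  FacialNonRepetitive : (Vertex n → ℕ) → Set
  FacialNonRepetitive φ =
    ∀ (f : Face) (s : ℕ) (d : Bool) (m : ℕ) → 1 ≤ m →
    IsPath (faceWalk f s d) (m + m) → ¬ Repetition φ (faceWalk f s d) m

  -- π_fl(A_n) ≤ l : every such list assignment admits a facial
  -- non-repetitive colouring from the lists
  FacialNonRepListChoosable : ℕ → Set
  FacialNonRepListChoosable l =
    ∀ (L : Vertex n → List ℕ) → (∀ x → Unique (L x)) → (∀ x → l ≤ length (L x)) →
    ∃ λ (φ : Vertex n → ℕ) → (∀ x → φ x ∈ L x) × FacialNonRepetitive φ

module Submission where

-- Colour v₀ with some a ∈ L(v₀) and u₀ with some b ∈ L(u₀), b ≠ a.  Colour v₁ … v_{n-1} by a
-- square-free word whose letters avoid a and b, and u₁ … u_{n-1} by a square-free word whose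
-- letters avoid b and the colours of the two v-neighbours, so that at least 7 − 3 = 4 choices
-- remain at every position.  Four choices per position always admit a square-free word:
-- putting a list of size ≥ 4 in front at least doubles the number of square-free choices,
-- since a spoilt word ww·y (with square-free tail) is determined by y, so the spoilt words
-- number at most the sum of the counts over all suffixes, which stays below twice the total.
-- A repetition along a cycle cannot contain the anchor, whose colour is unique on it, so it is
-- a square of the word; the triangles are rainbow and their facial paths have ≤ 3 vertices.

open import Defs
open import Data.Fin using (Fin; zero; suc; toℕ; fromℕ<)
open import Data.Fin.Properties using (toℕ-fromℕ<; fromℕ<-cong; fromℕ<-toℕ; toℕ<n)
open import Data.Vec using (lookup; _∷_; [])
open import Data.Bool using (Bool; true; false; _∧_; _∨_; not; T)
open import Data.Unit using (tt)
open import Data.Empty using (⊥; ⊥-elim)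
open import Data.List using (List; []; _∷_; length; _++_; take; drop; applyUpTo; filter)
open import Data.List.Properties using (take++drop≡id; length-take; length-drop; drop-drop; length-applyUpTo; filter-accept; filter-reject; filter-all)
open import Data.List.Membership.Propositional using (_∈_)
open import Data.List.Membership.Propositional.Properties using (∈-filter⁻)
open import Data.List.Relation.Binary.Pointwise using (Pointwise; []; _∷_; Pointwise-length)
open import Data.List.Relation.Unary.All using (All; []; _∷_)
import Data.List.Relation.Unary.All as All
import Data.List.Relation.Unary.All.Properties as Allₚ
open import Data.List.Relation.Unary.Any using (here; there)
open import Data.List.Relation.Unary.Unique.Propositional using (Unique)
open import Data.List.Relation.Unary.Unique.Propositional.Properties using (filter⁺)
open import Data.List.Relation.Unary.AllPairs using ([]; _∷_)
open import Data.Nat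
open import Data.Nat.Properties
open import Data.Nat.DivMod
open import Data.Nat.Tactic.RingSolver using (solve-∀)
open import Algebra.Properties.CommutativeSemigroup +-commutativeSemigroup
  using () renaming (interchange to +-interchange)
open import Data.Product using (∃; _×_; _,_; proj₁; proj₂)
open import Data.Sum using (inj₁; inj₂)
open import Relation.Binary.PropositionalEquality
  using (_≡_; _≢_; ≢-sym; refl; sym; trans; cong; cong₂; subst; subst₂; module ≡-Reasoning)
open import Relation.Nullary using (¬_; ¬?; yes; no; does)
open import Relation.Nullary.Decidable using (dec-true)
open import Function using (_∘_; case_of_)

ind : Bool → ℕ
ind true = 1
ind false = 0

ind-∧-monoʳ : ∀ a {b c} → (b ≡ true → c ≡ true) → ind (a ∧ b) ≤ ind (a ∧ c)
ind-∧-monoʳ false b⇒c = z≤n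
ind-∧-monoʳ true {false} b⇒c = z≤n
ind-∧-monoʳ true {true} b⇒c rewrite b⇒c refl = ≤-refl

ind-∧-∧ : ∀ a b c → ind ((a ∧ b) ∧ c) ≤ ind b * ind c
ind-∧-∧ false b c = z≤n
ind-∧-∧ true false c = z≤n
ind-∧-∧ true true false = z≤n
ind-∧-∧ true true true = ≤-refl

sumBelow : ℕ → (ℕ → ℕ) → ℕ
sumBelow zero f = 0
sumBelow (suc J) f = f 0 + sumBelow J (λ t → f (suc t))

sumBelow-mono : ∀ J {f g : ℕ → ℕ} → (∀ t → t < J → f t ≤ g t) → sumBelow J f ≤ sumBelow J g
sumBelow-mono zero f≤g = z≤n
sumBelow-mono (suc J) f≤g = +-mono-≤ (f≤g 0 z<s) (sumBelow-mono J (λ t t<J → f≤g (suc t) (s<s t<J)))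

anyBelow : ℕ → (ℕ → Bool) → Bool
anyBelow zero p = false
anyBelow (suc J) p = p 0 ∨ anyBelow J (λ t → p (suc t))

anyBelow-union : ∀ J (p : ℕ → Bool) q → ind (anyBelow J p ∧ q) ≤ sumBelow J (λ t → ind (p t ∧ q))
anyBelow-union zero p q = z≤n
anyBelow-union (suc J) p q with p 0
... | true = m≤m+n _ _
... | false = anyBelow-union J (λ t → p (suc t)) q

anyBelow-false : ∀ J p {t} → anyBelow J p ≡ false → t < J → p t ≡ false
anyBelow-false (suc J) p {zero} none t<J with p 0
... | false = refl
anyBelow-false (suc J) p {suc t} none (s<s t<J) with p 0
... | false = anyBelow-false J (λ t → p (suc t)) none t<J

-- Sums over the words chosen letter by letter from a sequence of lists

sumOver : List ℕ → (ℕ → ℕ) → ℕ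
sumOver [] f = 0
sumOver (c ∷ L) f = f c + sumOver L f

sumOver-cong : ∀ L {f g : ℕ → ℕ} → (∀ c → f c ≡ g c) → sumOver L f ≡ sumOver L g
sumOver-cong [] f≡g = refl
sumOver-cong (c ∷ L) f≡g = cong₂ _+_ (f≡g c) (sumOver-cong L f≡g)

sumOver-mono : ∀ L {f g : ℕ → ℕ} → (∀ c → c ∈ L → f c ≤ g c) → sumOver L f ≤ sumOver L g
sumOver-mono [] f≤g = z≤n
sumOver-mono (c ∷ L) f≤g = +-mono-≤ (f≤g c (here refl)) (sumOver-mono L (λ d d∈L → f≤g d (there d∈L)))

sumOver-+ : ∀ L (f g : ℕ → ℕ) → sumOver L (λ c → f c + g c) ≡ sumOver L f + sumOver L g
sumOver-+ [] f g = refl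
sumOver-+ (c ∷ L) f g rewrite sumOver-+ L f g = +-interchange (f c) (g c) _ _

sumOver-const : ∀ L k → sumOver L (λ _ → k) ≡ length L * k
sumOver-const [] k = refl
sumOver-const (c ∷ L) k = cong (k +_) (sumOver-const L k)

sumOver-*ʳ : ∀ L (f : ℕ → ℕ) k → sumOver L (λ c → f c * k) ≡ sumOver L f * k
sumOver-*ʳ [] f k = refl
sumOver-*ʳ (c ∷ L) f k rewrite sumOver-*ʳ L f k = sym (*-distribʳ-+ k (f c) _)

sumOver-pos : ∀ L (f : ℕ → ℕ) → 0 < sumOver L f → ∃ λ c → c ∈ L × 0 < f c
sumOver-pos (c ∷ L) f pos with f c in fc≡
... | suc _ = c , here refl , subst (0 <_) (sym fc≡) z<s
... | zero with sumOver-pos L f pos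
... | d , d∈L , fd>0 = d , there d∈L , fd>0

sumChoices : List (List ℕ) → (List ℕ → ℕ) → ℕ
sumChoices [] f = f []
sumChoices (L ∷ Ls) f = sumOver L (λ c → sumChoices Ls (λ w → f (c ∷ w)))

sumChoices-cong : ∀ Ls {f g : List ℕ → ℕ} → (∀ x → f x ≡ g x) → sumChoices Ls f ≡ sumChoices Ls g
sumChoices-cong [] f≡g = f≡g []
sumChoices-cong (L ∷ Ls) f≡g = sumOver-cong L (λ c → sumChoices-cong Ls (λ w → f≡g (c ∷ w)))

sumChoices-mono : ∀ Ls {f g : List ℕ → ℕ} → (∀ x → Pointwise _∈_ x Ls → f x ≤ g x) →
                  sumChoices Ls f ≤ sumChoices Ls g
sumChoices-mono [] f≤g = f≤g [] []
sumChoices-mono (L ∷ Ls) f≤g =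
  sumOver-mono L (λ c c∈L → sumChoices-mono Ls (λ w w∈Ls → f≤g (c ∷ w) (c∈L ∷ w∈Ls)))

sumChoices-zero : ∀ Ls → sumChoices Ls (λ _ → 0) ≡ 0
sumChoices-zero [] = refl
sumChoices-zero (L ∷ Ls) = begin
  sumOver L (λ c → sumChoices Ls (λ _ → 0)) ≡⟨ sumOver-cong L (λ _ → sumChoices-zero Ls) ⟩
  sumOver L (λ _ → 0)                       ≡⟨ sumOver-const L 0 ⟩
  length L * 0                              ≡⟨ *-zeroʳ (length L) ⟩
  0                                         ∎
  where open ≡-Reasoning

sumChoices-+ : ∀ Ls (f g : List ℕ → ℕ) → sumChoices Ls (λ x → f x + g x) ≡ sumChoices Ls f + sumChoices Ls g
sumChoices-+ [] f g = refl
sumChoices-+ (L ∷ Ls) f g = trans (sumOver-cong L (λ c → sumChoices-+ Ls _ _)) (sumOver-+ L _ _)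

sumChoices-*ʳ : ∀ Ls (f : List ℕ → ℕ) k → sumChoices Ls (λ x → f x * k) ≡ sumChoices Ls f * k
sumChoices-*ʳ [] f k = refl
sumChoices-*ʳ (L ∷ Ls) f k = trans (sumOver-cong L (λ c → sumChoices-*ʳ Ls _ k)) (sumOver-*ʳ L _ k)

sumOver-sumChoices-comm : ∀ L Ls (h : ℕ → List ℕ → ℕ) →
  sumOver L (λ c → sumChoices Ls (h c)) ≡ sumChoices Ls (λ y → sumOver L (λ c → h c y))
sumOver-sumChoices-comm [] Ls h = sym (sumChoices-zero Ls)
sumOver-sumChoices-comm (c ∷ L) Ls h =
  trans (cong (sumChoices Ls (h c) +_) (sumOver-sumChoices-comm L Ls h)) (sym (sumChoices-+ Ls _ _))

sumChoices-comm : ∀ As Bs (g : List ℕ → List ℕ → ℕ) →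
  sumChoices As (λ p → sumChoices Bs (g p)) ≡ sumChoices Bs (λ y → sumChoices As (λ p → g p y))
sumChoices-comm [] Bs g = refl
sumChoices-comm (L ∷ As) Bs g =
  trans (sumOver-cong L (λ c → sumChoices-comm As Bs (λ p → g (c ∷ p))))
        (sumOver-sumChoices-comm L Bs (λ c y → sumChoices As (λ p → g (c ∷ p) y)))

sumChoices-++ : ∀ As Bs (f : List ℕ → ℕ) →
  sumChoices (As ++ Bs) f ≡ sumChoices As (λ p → sumChoices Bs (λ y → f (p ++ y)))
sumChoices-++ [] Bs f = refl
sumChoices-++ (L ∷ As) Bs f = sumOver-cong L (λ c → sumChoices-++ As Bs (λ w → f (c ∷ w)))

sumChoices-sumBelow : ∀ Ls J (h : ℕ → List ℕ → ℕ) →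
  sumChoices Ls (λ x → sumBelow J (λ t → h t x)) ≡ sumBelow J (λ t → sumChoices Ls (h t))
sumChoices-sumBelow Ls zero h = sumChoices-zero Ls
sumChoices-sumBelow Ls (suc J) h =
  trans (sumChoices-+ Ls _ _) (cong (sumChoices Ls (h 0) +_) (sumChoices-sumBelow Ls J (λ t → h (suc t))))

sumChoices-pos : ∀ Ls (f : List ℕ → ℕ) → 0 < sumChoices Ls f → ∃ λ x → Pointwise _∈_ x Ls × 0 < f x
sumChoices-pos [] f pos = [] , [] , pos
sumChoices-pos (L ∷ Ls) f pos with sumOver-pos L _ pos
... | c , c∈L , pos′ with sumChoices-pos Ls _ pos′
... | w , w∈Ls , fw>0 = c ∷ w , c∈L ∷ w∈Ls , fw>0

-- Square-free words

sameList : List ℕ → List ℕ → Bool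
sameList [] [] = true
sameList [] (_ ∷ _) = false
sameList (_ ∷ _) [] = false
sameList (c ∷ p) (d ∷ q) = (c ≡ᵇ d) ∧ sameList p q

prefixSquare : ℕ → List ℕ → Bool
prefixSquare j x = does (j + j ≤? length x) ∧ sameList (take j x) (take j (drop j x))

hasPrefixSquare : List ℕ → Bool
hasPrefixSquare x = anyBelow (length x) (λ t → prefixSquare (suc t) x)

squareFree : List ℕ → Bool
squareFree [] = true
squareFree (c ∷ w) = not (hasPrefixSquare (c ∷ w)) ∧ squareFree w

squareFree-drop : ∀ k x → squareFree x ≡ true → squareFree (drop k x) ≡ true
squareFree-drop zero x sf = sf
squareFree-drop (suc k) [] sf = sf
squareFree-drop (suc k) (c ∷ w) sf with hasPrefixSquare (c ∷ w)
... | false = squareFree-drop k w sf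

≡ᵇ-true⇒≡ : ∀ c d → (c ≡ᵇ d) ≡ true → c ≡ d
≡ᵇ-true⇒≡ c d c≡ᵇd = ≡ᵇ⇒≡ c d (subst T (sym c≡ᵇd) tt)

sumOver-matching≤1 : ∀ L q → Unique L → sumOver L (λ c → ind (c ≡ᵇ q)) ≤ 1
sumOver-matching≤1 [] q [] = z≤n
sumOver-matching≤1 (c ∷ L) q (c∉L ∷ uniq) with c ≡ᵇ q in c≡ᵇq
... | false = sumOver-matching≤1 L q uniq
... | true rewrite ≡ᵇ-true⇒≡ c q c≡ᵇq = ≤-reflexive (cong suc (none L c∉L))
  where
  none : ∀ L → All (q ≢_) L → sumOver L (λ d → ind (d ≡ᵇ q)) ≡ 0
  none [] [] = refl
  none (d ∷ L) (q≢d ∷ q∉L) with d ≡ᵇ q in d≡ᵇq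
  ... | true = ⊥-elim (q≢d (sym (≡ᵇ-true⇒≡ d q d≡ᵇq)))
  ... | false = none L q∉L

sumChoices-sameList≤1 : ∀ As q → All Unique As → sumChoices As (λ p → ind (sameList p q)) ≤ 1
sumChoices-sameList≤1 [] [] [] = ≤-refl
sumChoices-sameList≤1 [] (_ ∷ _) [] = z≤n
sumChoices-sameList≤1 (L ∷ As) [] (_ ∷ _) = ≤-trans (≤-reflexive (sumChoices-zero (L ∷ As))) z≤n
sumChoices-sameList≤1 (L ∷ As) (d ∷ q) (uniq ∷ uniqs) =
  ≤-trans (sumOver-mono L (λ c _ → matching c)) (sumOver-matching≤1 L d uniq)
  where
  matching : ∀ c → sumChoices As (λ p → ind (sameList (c ∷ p) (d ∷ q))) ≤ ind (c ≡ᵇ d)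
  matching c with c ≡ᵇ d
  ... | true = sumChoices-sameList≤1 As q uniqs
  ... | false = ≤-reflexive (sumChoices-zero As)

take-length-++ : ∀ (p y : List ℕ) → take (length p) (p ++ y) ≡ p
take-length-++ [] y = refl
take-length-++ (c ∷ p) y = cong (c ∷_) (take-length-++ p y)

drop-length-++ : ∀ (p y : List ℕ) → drop (length p) (p ++ y) ≡ y
drop-length-++ [] y = refl
drop-length-++ (c ∷ p) y = drop-length-++ p y

numSquareFree : List (List ℕ) → ℕ
numSquareFree Ls = sumChoices Ls (λ x → ind (squareFree x))

-- A prefix square ww of a word wy is determined by y, so such words with y square-free
-- are at most as many as the square-free choices of y.
prefixSquares≤ : ∀ j Ls → All Unique Ls → j ≤ length Ls →
  sumChoices Ls (λ x → ind (prefixSquare j x ∧ squareFree (drop j x))) ≤ numSquareFree (drop j Ls)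
prefixSquares≤ j Ls uniq j≤len = begin
  sumChoices Ls f
    ≡⟨ cong (λ Ks → sumChoices Ks f) (sym (take++drop≡id j Ls)) ⟩
  sumChoices (As ++ Bs) f
    ≡⟨ sumChoices-++ As Bs f ⟩
  sumChoices As (λ p → sumChoices Bs (λ y → f (p ++ y)))
    ≤⟨ sumChoices-mono As (λ p p∈As → sumChoices-mono Bs (λ y _ → square-determined p y (lenAs p p∈As))) ⟩
  sumChoices As (λ p → sumChoices Bs (g p))
    ≡⟨ sumChoices-comm As Bs g ⟩
  sumChoices Bs (λ y → sumChoices As (λ p → g p y))
    ≡⟨ sumChoices-cong Bs (λ y → sumChoices-*ʳ As _ (ind (squareFree y))) ⟩
  sumChoices Bs (λ y → sumChoices As (λ p → ind (sameList p (take j y))) * ind (squareFree y))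
    ≤⟨ sumChoices-mono Bs (λ y _ → *-monoˡ-≤ (ind (squareFree y))
         (sumChoices-sameList≤1 As (take j y) (Allₚ.take⁺ j uniq))) ⟩
  sumChoices Bs (λ y → 1 * ind (squareFree y))
    ≡⟨ sumChoices-cong Bs (λ y → *-identityˡ (ind (squareFree y))) ⟩
  numSquareFree Bs
    ∎
  where
  open ≤-Reasoning
  As = take j Ls
  Bs = drop j Ls
  f : List ℕ → ℕ
  f x = ind (prefixSquare j x ∧ squareFree (drop j x))
  g : List ℕ → List ℕ → ℕ
  g p y = ind (sameList p (take j y)) * ind (squareFree y)
  lenAs : ∀ p → Pointwise _∈_ p As → length p ≡ j
  lenAs p p∈As = trans (Pointwise-length p∈As) (trans (length-take j Ls) (m≤n⇒m⊓n≡m j≤len))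
  square-determined : ∀ p y → length p ≡ j → f (p ++ y) ≤ g p y
  square-determined p y refl rewrite take-length-++ p y | drop-length-++ p y =
    ind-∧-∧ (does (length p + length p ≤? length (p ++ y))) _ _

suffixSum : List (List ℕ) → ℕ
suffixSum Ls = sumBelow (suc (length Ls)) (λ t → numSquareFree (drop t Ls))

newSquares≤suffixSum : ∀ L Ls → All Unique (L ∷ Ls) →
  sumChoices (L ∷ Ls) (λ x → ind (hasPrefixSquare x ∧ squareFree (drop 1 x))) ≤ suffixSum Ls
newSquares≤suffixSum L Ls uniq = begin
  sumChoices (L ∷ Ls) (λ x → ind (hasPrefixSquare x ∧ squareFree (drop 1 x)))
    ≤⟨ sumChoices-mono (L ∷ Ls) (λ x x∈ → union-bound x (Pointwise-length x∈)) ⟩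
  sumChoices (L ∷ Ls) (λ x → sumBelow J (λ t → squareAt t x))
    ≡⟨ sumChoices-sumBelow (L ∷ Ls) J squareAt ⟩
  sumBelow J (λ t → sumChoices (L ∷ Ls) (squareAt t))
    ≤⟨ sumBelow-mono J (λ t t<J → prefixSquares≤ (suc t) (L ∷ Ls) uniq t<J) ⟩
  suffixSum Ls
    ∎
  where
  open ≤-Reasoning
  J = suc (length Ls)
  squareAt : ℕ → List ℕ → ℕ
  squareAt t x = ind (prefixSquare (suc t) x ∧ squareFree (drop (suc t) x))
  union-bound : ∀ x → length x ≡ J → ind (hasPrefixSquare x ∧ squareFree (drop 1 x)) ≤ sumBelow J (λ t → squareAt t x)
  union-bound x len≡J = begin
    ind (hasPrefixSquare x ∧ squareFree (drop 1 x))
      ≤⟨ anyBelow-union (length x) (λ t → prefixSquare (suc t) x) _ ⟩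
    sumBelow (length x) (λ t → ind (prefixSquare (suc t) x ∧ squareFree (drop 1 x)))
      ≤⟨ sumBelow-mono (length x) (λ t _ → ind-∧-monoʳ (prefixSquare (suc t) x)
           (λ sf → subst (λ y → squareFree y ≡ true) (drop-drop 1 t x) (squareFree-drop t (drop 1 x) sf))) ⟩
    sumBelow (length x) (λ t → squareAt t x)
      ≡⟨ cong (λ k → sumBelow k (λ t → squareAt t x)) len≡J ⟩
    sumBelow J (λ t → squareAt t x)
      ∎

squareFree-tail≤ : ∀ x → ind (squareFree (drop 1 x)) ≤ ind (squareFree x) + ind (hasPrefixSquare x ∧ squareFree (drop 1 x))
squareFree-tail≤ [] = s≤s z≤n
squareFree-tail≤ (c ∷ w) with hasPrefixSquare (c ∷ w) | squareFree w
... | true | true = s≤s z≤n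
... | true | false = z≤n
... | false | true = s≤s z≤n
... | false | false = z≤n

-- The bound on suffixSum is the invariant that lets each new list double the count.
squareFree-count : ∀ Ls → All (λ L → Unique L × 4 ≤ length L) Ls →
  1 ≤ numSquareFree Ls × suffixSum Ls ≤ 2 * numSquareFree Ls
squareFree-count [] [] = s≤s z≤n , s≤s z≤n
squareFree-count (L ∷ Ls) ((uniq , 4≤len) ∷ good)
  with squareFree-count Ls good
... | 1≤g , s≤2g = ≤-trans 1≤g (≤-trans (m≤m+n g _) doubling) , (begin
    g′ + s        ≤⟨ +-monoʳ-≤ g′ (≤-trans s≤2g doubling) ⟩
    g′ + g′       ≡⟨ cong (g′ +_) (sym (+-identityʳ g′)) ⟩
    2 * g′        ∎)
  where
  open ≤-Reasoning
  g = numSquareFree Ls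
  g′ = numSquareFree (L ∷ Ls)
  s = suffixSum Ls
  spoilt = sumChoices (L ∷ Ls) (λ x → ind (hasPrefixSquare x ∧ squareFree (drop 1 x)))
  4g≤g′+2g : 4 * g ≤ g′ + 2 * g
  4g≤g′+2g = begin
    4 * g          ≤⟨ *-monoˡ-≤ g 4≤len ⟩
    length L * g   ≡⟨ sym (sumOver-const L g) ⟩
    sumChoices (L ∷ Ls) (λ x → ind (squareFree (drop 1 x)))
                   ≤⟨ sumChoices-mono (L ∷ Ls) (λ x _ → squareFree-tail≤ x) ⟩
    sumChoices (L ∷ Ls) (λ x → ind (squareFree x) + ind (hasPrefixSquare x ∧ squareFree (drop 1 x)))
                   ≡⟨ sumChoices-+ (L ∷ Ls) (λ x → ind (squareFree x)) (λ x → ind (hasPrefixSquare x ∧ squareFree (drop 1 x))) ⟩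
    g′ + spoilt    ≤⟨ +-monoʳ-≤ g′ (newSquares≤suffixSum L Ls (uniq ∷ All.map proj₁ good)) ⟩
    g′ + s         ≤⟨ +-monoʳ-≤ g′ s≤2g ⟩
    g′ + 2 * g     ∎
  doubling : 2 * g ≤ g′
  doubling = +-cancelʳ-≤ (2 * g) (2 * g) g′ (≤-trans (≤-reflexive (2g+2g≡4g g)) 4g≤g′+2g)
    where
    2g+2g≡4g : ∀ g → 2 * g + 2 * g ≡ 4 * g
    2g+2g≡4g = solve-∀

squareFree-choice : ∀ Ls → All (λ L → Unique L × 4 ≤ length L) Ls →
  ∃ λ x → Pointwise _∈_ x Ls × squareFree x ≡ true
squareFree-choice Ls good with sumChoices-pos Ls _ (proj₁ (squareFree-count Ls good))
... | x , x∈Ls , sf = x , x∈Ls , ind-pos sf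
  where
  ind-pos : ∀ {b} → 0 < ind b → b ≡ true
  ind-pos {true} _ = refl

-- junk value 0 past the end of the word
nth : List ℕ → ℕ → ℕ
nth [] _ = 0
nth (c ∷ w) zero = c
nth (c ∷ w) (suc k) = nth w k

nth-drop : ∀ o x j → nth (drop o x) j ≡ nth x (o + j)
nth-drop zero x j = refl
nth-drop (suc o) [] j = refl
nth-drop (suc o) (c ∷ x) j = nth-drop o x j

sameList-take : ∀ m p q → m ≤ length p → m ≤ length q →
  (∀ j → j < m → nth p j ≡ nth q j) → sameList (take m p) (take m q) ≡ true
sameList-take zero p q _ _ _ = refl
sameList-take (suc m) (c ∷ p) (d ∷ q) (s≤s m≤p) (s≤s m≤q) p≡q with p≡q 0 z<s
... | refl rewrite dec-true (c ≟ c) refl = sameList-take m p q m≤p m≤q (λ j j<m → p≡q (suc j) (s<s j<m))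

squareFree⇒¬prefixSquare : ∀ y m → squareFree y ≡ true → 1 ≤ m → m ≤ length y → prefixSquare m y ≡ false
squareFree⇒¬prefixSquare (c ∷ w) (suc t) sf _ (s≤s t≤w) with hasPrefixSquare (c ∷ w) in noSquare
... | false = anyBelow-false (suc (length w)) (λ t → prefixSquare (suc t) (c ∷ w)) noSquare (s≤s t≤w)

squareFree⇒¬repetition : ∀ x o m → squareFree x ≡ true → 1 ≤ m → o + (m + m) ≤ length x →
  ¬ (∀ j → j < m → nth x (o + j) ≡ nth x (o + m + j))
squareFree⇒¬repetition x o m sf 1≤m fits rep =
  case trans (sym (squareFree⇒¬prefixSquare y m (squareFree-drop o x sf) 1≤m m≤y)) square of λ ()
  where
  y = drop o x
  m+m≤y : m + m ≤ length y
  m+m≤y = subst (m + m ≤_) (sym (length-drop o x)) (≤-trans (≤-reflexive (sym (m+n∸m≡n o (m + m)))) (∸-monoˡ-≤ o fits))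
  m≤y : m ≤ length y
  m≤y = ≤-trans (m≤m+n m m) m+m≤y
  m≤dropy : m ≤ length (drop m y)
  m≤dropy = subst (m ≤_) (sym (length-drop m y)) (≤-trans (≤-reflexive (sym (m+n∸n≡m m m))) (∸-monoˡ-≤ m m+m≤y))
  repetition : ∀ j → j < m → nth y j ≡ nth (drop m y) j
  repetition j j<m = begin
    nth y j               ≡⟨ nth-drop o x j ⟩
    nth x (o + j)         ≡⟨ rep j j<m ⟩
    nth x (o + m + j)     ≡⟨ cong (nth x) (+-assoc o m j) ⟩
    nth x (o + (m + j))   ≡⟨ sym (nth-drop o x (m + j)) ⟩
    nth y (m + j)         ≡⟨ sym (nth-drop m y j) ⟩
    nth (drop m y) j      ∎
    where open ≡-Reasoning
  square : prefixSquare m y ≡ true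
  square rewrite dec-true (m + m ≤? length y) m+m≤y = sameList-take m y (drop m y) m≤y m≤dropy repetition

record SquareFreeChoice (g : ℕ → List ℕ) (k : ℕ) : Set where
  field
    word : List ℕ
    word-squareFree : squareFree word ≡ true
    word-length : length word ≡ k
    word-∈ : ∀ t → t < k → nth word t ∈ g t

Pointwise-applyUpTo-nth : ∀ (g : ℕ → List ℕ) k {x} → Pointwise _∈_ x (applyUpTo g k) →
  ∀ t → t < k → nth x t ∈ g t
Pointwise-applyUpTo-nth g (suc k) (c∈ ∷ x∈) zero _ = c∈
Pointwise-applyUpTo-nth g (suc k) (c∈ ∷ x∈) (suc t) (s<s t<k) = Pointwise-applyUpTo-nth (g ∘ suc) k x∈ t t<k

squareFree-choice-indexed : ∀ (g : ℕ → List ℕ) k → (∀ t → Unique (g t) × 4 ≤ length (g t)) → SquareFreeChoice g k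
squareFree-choice-indexed g k good with squareFree-choice (applyUpTo g k) (Allₚ.applyUpTo⁺₂ g k good)
... | x , x∈ , sf = record
  { word = x
  ; word-squareFree = sf
  ; word-length = trans (Pointwise-length x∈) (length-applyUpTo g k)
  ; word-∈ = Pointwise-applyUpTo-nth g k x∈
  }

remove : ℕ → List ℕ → List ℕ
remove e = filter (λ c → ¬? (c ≟ e))

_∖_ : List ℕ → List ℕ → List ℕ
L ∖ [] = L
L ∖ (e ∷ F) = remove e (L ∖ F)

∈-∖⁻ : ∀ L F {c} → c ∈ L ∖ F → c ∈ L × All (c ≢_) F
∈-∖⁻ L [] c∈L = c∈L , []
∈-∖⁻ L (e ∷ F) c∈ with ∈-filter⁻ (λ c → ¬? (c ≟ e)) c∈
... | c∈L∖F , c≢e with ∈-∖⁻ L F c∈L∖F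
... | c∈L , c∉F = c∈L , c≢e ∷ c∉F

∖-unique : ∀ F {L} → Unique L → Unique (L ∖ F)
∖-unique [] uniq = uniq
∖-unique (e ∷ F) uniq = filter⁺ (λ c → ¬? (c ≟ e)) (∖-unique F uniq)

length-remove : ∀ e L → Unique L → length L ≤ suc (length (remove e L))
length-remove e [] [] = z≤n
length-remove e (c ∷ L) (c∉L ∷ uniq) with c ≟ e
... | no c≢e = subst (λ K → suc (length L) ≤ suc (length K)) (sym (filter-accept (λ d → ¬? (d ≟ e)) c≢e))
                    (s≤s (length-remove e L uniq))
... | yes refl = ≤-reflexive (cong (suc ∘ length) (sym (begin
  remove c (c ∷ L)   ≡⟨ filter-reject (λ d → ¬? (d ≟ c)) (λ c≢c → c≢c refl) ⟩
  remove c L         ≡⟨ filter-all (λ d → ¬? (d ≟ c)) (All.map ≢-sym c∉L) ⟩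
  L                  ∎)))
  where open ≡-Reasoning

length-∖ : ∀ F L → Unique L → length L ≤ length F + length (L ∖ F)
length-∖ [] L _ = ≤-refl
length-∖ (e ∷ F) L uniq = begin
  length L                                         ≤⟨ length-∖ F L uniq ⟩
  length F + length (L ∖ F)                        ≤⟨ +-monoʳ-≤ (length F) (length-remove e (L ∖ F) (∖-unique F uniq)) ⟩
  length F + suc (length (remove e (L ∖ F)))       ≡⟨ +-suc (length F) _ ⟩
  suc (length F + length (remove e (L ∖ F)))       ∎
  where open ≤-Reasoning

∖-good : ∀ L F k → Unique L → length F + k ≤ length L → Unique (L ∖ F) × k ≤ length (L ∖ F)
∖-good L F k uniq fits = ∖-unique F uniq , +-cancelˡ-≤ (length F) k _ (≤-trans fits (length-∖ F L uniq))

-- Repetitions along walks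

RepetitionFreeWindow : {V : Set} → (V → ℕ) → (ℕ → V) → ℕ → Set
RepetitionFreeWindow φ w m =
  (∀ i j → i < m + m → j < m + m → w i ≡ w j → i ≡ j) → ¬ (∀ j → j < m → φ (w j) ≡ φ (w (m + j)))

RepetitionFreeWalk : {V : Set} → (V → ℕ) → (ℕ → V) → Set
RepetitionFreeWalk φ w = ∀ m → 1 ≤ m → RepetitionFreeWindow φ w m

RepetitionFreeWalk-transfer : {U V : Set} {φ : U → ℕ} {κ : V → ℕ} {w : ℕ → U} {p : ℕ → V} →
  (∀ j → φ (w j) ≡ κ (p j)) → (∀ i j → p i ≡ p j → w i ≡ w j) →
  RepetitionFreeWalk κ p → RepetitionFreeWalk φ w
RepetitionFreeWalk-transfer φw≡κp p⇒w free m 1≤m w-inj rep =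
  free m 1≤m (λ i j i< j< pi≡pj → w-inj i j i< j< (p⇒w i j pi≡pj))
             (λ j j<m → trans (sym (φw≡κp j)) (trans (rep j j<m) (φw≡κp (m + j))))

-- A colour occurring only at v cannot lie on a repetition: its partner would carry it too.
repetition-avoids-unique : {V : Set} {φ : V → ℕ} {w : ℕ → V} {v : V} (m : ℕ) → 1 ≤ m →
  (∀ j → j < m + m → φ (w j) ≡ φ v → w j ≡ v) →
  (∀ i j → i < m + m → j < m + m → w i ≡ w j → i ≡ j) →
  (∀ j → j < m → φ (w j) ≡ φ (w (m + j))) →
  ∀ j → j < m + m → w j ≢ v
repetition-avoids-unique {φ = φ} {w} {v} m 1≤m unique inj rep j j<2m wj≡v = case j <? m of λ where
    (yes j<m) → separated j j<m (trans wj≡v (sym (unique (m + j) (+-monoʳ-< m j<m)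
                  (trans (sym (rep j j<m)) (cong φ wj≡v)))))
    (no j≮m) → separated k k<m (trans (unique k (≤-trans k<m (m≤m+n m m)) (trans (rep k k<m) (cong φ (w[m+k]≡v j≮m))))
                                      (sym (w[m+k]≡v j≮m)))
  where
  separated : ∀ k → k < m → w k ≢ w (m + k)
  separated k k<m eq = m+n≢n m k 1≤m (sym (inj k (m + k) (≤-trans k<m (m≤m+n m m)) (+-monoʳ-< m k<m) eq))
    where
    m+n≢n : ∀ m n → 1 ≤ m → m + n ≢ n
    m+n≢n (suc m) n _ = m≢1+n+m n ∘ sym
  k = j ∸ m
  k<m : k < m
  k<m = m<n+o⇒m∸n<o j m {{>-nonZero 1≤m}} j<2m
  w[m+k]≡v : j ≮ m → w (m + k) ≡ v
  w[m+k]≡v j≮m = trans (cong w (m+[n∸m]≡n (≮⇒≥ j≮m))) wj≡v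

RepetitionFreeWindow-reverse : {V : Set} {φ : V → ℕ} {w w′ : ℕ → V} (m′ : ℕ) →
  (∀ j → j < suc m′ + suc m′ → w′ j ≡ w (m′ + suc m′ ∸ j)) →
  RepetitionFreeWindow φ w (suc m′) → RepetitionFreeWindow φ w′ (suc m′)
RepetitionFreeWindow-reverse {φ = φ} {w} {w′} m′ w′≡w free w′-inj rep′ = free w-inj rep
  where
  m = suc m′
  K = m′ + m
  w≡w′ : ∀ i → i < m + m → w i ≡ w′ (K ∸ i)
  w≡w′ i i<2m = sym (trans (w′≡w (K ∸ i) (s≤s (m∸n≤m K i))) (cong w (m∸[m∸n]≡n (s≤s⁻¹ i<2m))))
  w-inj : ∀ i j → i < m + m → j < m + m → w i ≡ w j → i ≡ j
  w-inj i j i<2m j<2m wi≡wj = begin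
    i            ≡⟨ sym (m∸[m∸n]≡n (s≤s⁻¹ i<2m)) ⟩
    K ∸ (K ∸ i)  ≡⟨ cong (K ∸_) (w′-inj (K ∸ i) (K ∸ j) (s≤s (m∸n≤m K i)) (s≤s (m∸n≤m K j))
                      (trans (sym (w≡w′ i i<2m)) (trans wi≡wj (w≡w′ j j<2m)))) ⟩
    K ∸ (K ∸ j)  ≡⟨ m∸[m∸n]≡n (s≤s⁻¹ j<2m) ⟩
    j            ∎
    where open ≡-Reasoning
  rep : ∀ j → j < m → φ (w j) ≡ φ (w (m + j))
  rep j j<m = begin
    φ (w j)              ≡⟨ cong φ (w≡w′ j (≤-trans j<m (m≤m+n m m))) ⟩
    φ (w′ (K ∸ j))       ≡⟨ cong (φ ∘ w′) K∸j≡m+k ⟩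
    φ (w′ (m + k))       ≡⟨ sym (rep′ k (s≤s (m∸n≤m m′ j))) ⟩
    φ (w′ k)             ≡⟨ cong (φ ∘ w′) (sym K∸[m+j]≡k) ⟩
    φ (w′ (K ∸ (m + j))) ≡⟨ cong φ (sym (w≡w′ (m + j) (+-monoʳ-< m j<m))) ⟩
    φ (w (m + j))        ∎
    where
    open ≡-Reasoning
    k = m′ ∸ j
    K∸j≡m+k : K ∸ j ≡ m + k
    K∸j≡m+k = trans (+-∸-comm m (s≤s⁻¹ j<m)) (+-comm k m)
    K∸[m+j]≡k : K ∸ (m + j) ≡ k
    K∸[m+j]≡k = trans (sym (∸-+-assoc K m j)) (cong (_∸ j) (m+n∸n≡m m′ m))

-- Cycles

%-shift : ∀ s j n .{{_ : NonZero n}} → (s + j) % n ≡ (s % n + j) % n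
%-shift s j n = begin
  (s + j) % n                  ≡⟨ %-distribˡ-+ s j n ⟩
  (s % n + j % n) % n          ≡⟨ cong (λ r → (r + j % n) % n) (sym (m%n%n≡m%n s n)) ⟩
  (s % n % n + j % n) % n      ≡⟨ sym (%-distribˡ-+ (s % n) j n) ⟩
  (s % n + j) % n              ∎
  where open ≡-Reasoning

anchored : ℕ → List ℕ → ℕ → ℕ
anchored a x zero = a
anchored a x (suc t) = nth x t

-- A repetition on the cycle avoids the anchor, whose colour a is unique, so it does not
-- wrap around and is a square of x.
cycle-repetitionFree : ∀ N a x → squareFree x ≡ true → length x ≡ N → (∀ t → t < N → nth x t ≢ a) →
  ∀ s → RepetitionFreeWalk (anchored a x) (λ j → (s + j) % suc N)
cycle-repetitionFree N a x sf len a∉x s m 1≤m inj rep = start (s % n) refl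
  where
  n = suc N
  pos : ℕ → ℕ
  pos j = (s + j) % n
  anchor-unique : ∀ j → j < m + m → anchored a x (pos j) ≡ a → pos j ≡ 0
  anchor-unique j _ = unique (pos j) (m%n<n (s + j) n)
    where
    unique : ∀ r → r < n → anchored a x r ≡ a → r ≡ 0
    unique zero _ _ = refl
    unique (suc t) (s<s t<N) nth≡a = ⊥-elim (a∉x t t<N nth≡a)
  avoids : ∀ j → j < m + m → pos j ≢ 0
  avoids = repetition-avoids-unique {φ = anchored a x} m 1≤m anchor-unique inj rep
  start : ∀ r → s % n ≡ r → ⊥
  start zero s%n≡0 = avoids 0 (≤-trans 1≤m (m≤m+n m m)) (trans (%-shift s 0 n) (cong (λ r → (r + 0) % n) s%n≡0))
  start (suc o) s%n≡1+o with o + (m + m) ≤? N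
  ... | yes fits = squareFree⇒¬repetition x o m sf 1≤m (subst (o + (m + m) ≤_) (sym len) fits) square
    where
    pos-inside : ∀ j → j < m + m → pos j ≡ suc (o + j)
    pos-inside j j<2m = begin
      pos j                  ≡⟨ %-shift s j n ⟩
      (s % n + j) % n        ≡⟨ cong (λ r → (r + j) % n) s%n≡1+o ⟩
      suc (o + j) % n        ≡⟨ m<n⇒m%n≡m (s≤s (≤-trans (+-monoʳ-< o j<2m) fits)) ⟩
      suc (o + j)            ∎
      where open ≡-Reasoning
    square : ∀ j → j < m → nth x (o + j) ≡ nth x (o + m + j)
    square j j<m = begin
      nth x (o + j)                 ≡⟨ cong (anchored a x) (sym (pos-inside j (≤-trans j<m (m≤m+n m m)))) ⟩
      anchored a x (pos j)          ≡⟨ rep j j<m ⟩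
      anchored a x (pos (m + j))    ≡⟨ cong (anchored a x) (pos-inside (m + j) (+-monoʳ-< m j<m)) ⟩
      nth x (o + (m + j))           ≡⟨ cong (nth x) (sym (+-assoc o m j)) ⟩
      nth x (o + m + j)             ∎
      where open ≡-Reasoning
  ... | no wraps = avoids (N ∸ o) (m<n+o⇒m∸n<o N o {{>-nonZero (≤-trans 1≤m (m≤m+n m m))}} (≰⇒> wraps)) (begin
      pos (N ∸ o)                ≡⟨ %-shift s (N ∸ o) n ⟩
      (s % n + (N ∸ o)) % n      ≡⟨ cong (λ r → (r + (N ∸ o)) % n) s%n≡1+o ⟩
      suc (o + (N ∸ o)) % n      ≡⟨ cong (λ r → suc r % n) (m+[n∸m]≡n o≤N) ⟩
      n % n                      ≡⟨ n%n≡0 n ⟩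
      0                          ∎)
    where
    open ≡-Reasoning
    o≤N : o ≤ N
    o≤N = <⇒≤ (s≤s⁻¹ (subst (_< n) s%n≡1+o (m%n<n s n)))

-- Walking backwards from s is walking forwards, in reverse, from the other end of the window.
cycle-backward : ∀ N (κ : ℕ → ℕ) → (∀ s → RepetitionFreeWalk κ (λ j → (s + j) % suc N)) →
  ∀ s → RepetitionFreeWalk κ (λ j → (s + N * j) % suc N)
cycle-backward N κ forward s m@(suc m′) 1≤m =
  RepetitionFreeWindow-reverse {φ = κ} m′ reversed (forward (s + N * K) m 1≤m)
  where
  n = suc N
  K = m′ + m
  reversed : ∀ j → j < m + m → (s + N * j) % n ≡ (s + N * K + (K ∸ j)) % n
  reversed j j<2m = sym (begin
    (s + N * K + i) % n           ≡⟨ cong (λ k → (s + N * k + i) % n) (sym (m∸n+n≡m (s≤s⁻¹ j<2m))) ⟩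
    (s + N * (i + j) + i) % n     ≡⟨ cong (_% n) (regroup s N i j) ⟩
    (s + N * j + i * n) % n       ≡⟨ [m+kn]%n≡m%n (s + N * j) i n ⟩
    (s + N * j) % n               ∎)
    where
    open ≡-Reasoning
    i = K ∸ j
    regroup : ∀ s N i j → s + N * (i + j) + i ≡ s + N * j + i * suc N
    regroup = solve-∀

-- Triangles

Rainbow : {V : Set} → (V → ℕ) → V → V → V → Set
Rainbow φ A B C = φ A ≢ φ B × φ A ≢ φ C × φ B ≢ φ C

triangle-repetitionFree : {V : Set} (φ : V → ℕ) (A B C : V) → Rainbow φ A B C →
  (g : ℕ → ℕ) → g 3 % 3 ≡ g 0 % 3 → RepetitionFreeWalk φ (λ j → lookup (A ∷ B ∷ C ∷ []) (idx 3 (g j)))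
triangle-repetitionFree φ A B C (ab , ac , bc) g period (suc zero) _ inj rep =
  case inj 0 1 z<s (s<s z<s) (colour-injective (idx 3 (g 0)) (idx 3 (g 1)) (rep 0 z<s)) of λ ()
  where
  colour-injective : ∀ k l → φ (lookup (A ∷ B ∷ C ∷ []) k) ≡ φ (lookup (A ∷ B ∷ C ∷ []) l) →
                     lookup (A ∷ B ∷ C ∷ []) k ≡ lookup (A ∷ B ∷ C ∷ []) l
  colour-injective zero zero _ = refl
  colour-injective zero (suc zero) eq = ⊥-elim (ab eq)
  colour-injective zero (suc (suc zero)) eq = ⊥-elim (ac eq)
  colour-injective (suc zero) zero eq = ⊥-elim (ab (sym eq))
  colour-injective (suc zero) (suc zero) _ = refl
  colour-injective (suc zero) (suc (suc zero)) eq = ⊥-elim (bc eq)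
  colour-injective (suc (suc zero)) zero eq = ⊥-elim (ac (sym eq))
  colour-injective (suc (suc zero)) (suc zero) eq = ⊥-elim (bc (sym eq))
  colour-injective (suc (suc zero)) (suc (suc zero)) _ = refl
triangle-repetitionFree φ A B C _ g period (suc (suc m)) _ inj rep =
  case inj 0 3 z<s (s<s (s<s (≤-trans (s≤s (s≤s z≤n)) (m≤n+m (suc (suc m)) m)))) walk₀≡walk₃ of λ ()
  where
  walk₀≡walk₃ : lookup (A ∷ B ∷ C ∷ []) (idx 3 (g 0)) ≡ lookup (A ∷ B ∷ C ∷ []) (idx 3 (g 3))
  walk₀≡walk₃ = cong (lookup (A ∷ B ∷ C ∷ [])) (fromℕ<-cong _ _ (sym period) (m%n<n (g 0) 3) (m%n<n (g 3) 3))

-- The antiprism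

suc[r+N]%n≡r%n : ∀ r N → suc (r + N) % suc N ≡ r % suc N
suc[r+N]%n≡r%n r N = trans (cong (_% suc N) (sym (+-suc r N))) ([m+n]%n≡m%n r (suc N))

%-suc-≢ : ∀ N → 1 ≤ N → ∀ s → s % suc N ≢ suc s % suc N
%-suc-≢ N 1≤N s eq = residue-suc-≢ (s % n) (m%n<n s n) (begin
    s % n % n          ≡⟨ m%n%n≡m%n s n ⟩
    s % n              ≡⟨ eq ⟩
    suc s % n          ≡⟨ cong (_% n) (+-comm 1 s) ⟩
    (s + 1) % n        ≡⟨ %-shift s 1 n ⟩
    (s % n + 1) % n    ≡⟨ cong (_% n) (+-comm (s % n) 1) ⟩
    suc (s % n) % n    ∎)
  where
  open ≡-Reasoning
  n = suc N
  residue-suc-≢ : ∀ r → r < n → r % n ≢ suc r % n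
  residue-suc-≢ r r<n rewrite m<n⇒m%n≡m r<n with suc r <? n
  ... | yes 1+r<n rewrite m<n⇒m%n≡m 1+r<n = 1+n≢n ∘ sym
  ... | no 1+r≮n = λ r≡1+r%n → case subst (1 ≤_) (trans (sym r≡N) (trans r≡1+r%n 1+r%n≡0)) 1≤N of λ ()
    where
    1+r≡n : suc r ≡ n
    1+r≡n = ≤-antisym r<n (≮⇒≥ 1+r≮n)
    r≡N : r ≡ N
    r≡N = suc-injective 1+r≡n
    1+r%n≡0 : suc r % n ≡ 0
    1+r%n≡0 = trans (cong (_% n) 1+r≡n) (n%n≡0 n)

cycle-adjacent : ∀ N (κ : ℕ → ℕ) → 1 ≤ N → (∀ s → RepetitionFreeWalk κ (λ j → (s + j) % suc N)) →
  ∀ s → κ (s % suc N) ≢ κ (suc s % suc N)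
cycle-adjacent N κ 1≤N forward s κs≡κ[1+s] =
  forward s 1 ≤-refl inj λ { zero _ → trans (cong κ s+0≡s) (trans κs≡κ[1+s] (cong κ 1+s≡s+1)) ; (suc _) (s≤s ()) }
  where
  n = suc N
  s+0≡s : (s + 0) % n ≡ s % n
  s+0≡s = cong (_% n) (+-identityʳ s)
  1+s≡s+1 : suc s % n ≡ (s + 1) % n
  1+s≡s+1 = cong (_% n) (+-comm 1 s)
  inj : ∀ i j → i < 2 → j < 2 → (s + i) % n ≡ (s + j) % n → i ≡ j
  inj zero zero _ _ _ = refl
  inj zero (suc zero) _ _ eq = ⊥-elim (%-suc-≢ N 1≤N s (trans (sym s+0≡s) (trans eq (sym 1+s≡s+1))))
  inj (suc zero) zero _ _ eq = ⊥-elim (%-suc-≢ N 1≤N s (trans (sym s+0≡s) (trans (sym eq) (sym 1+s≡s+1))))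
  inj (suc zero) (suc zero) _ _ _ = refl
  inj (suc (suc _)) _ (s≤s (s≤s ())) _ _
  inj _ (suc (suc _)) _ (s≤s (s≤s ())) _

idx-toℕ : ∀ {n} .{{_ : NonZero n}} (i : Fin n) → idx n (toℕ i) ≡ i
idx-toℕ i = trans (fromℕ<-cong _ _ (m<n⇒m%n≡m (toℕ<n i)) _ (toℕ<n i)) (fromℕ<-toℕ i (toℕ<n i))

∈-nonempty : ∀ (K : List ℕ) → 1 ≤ length K → ∃ (_∈ K)
∈-nonempty (c ∷ _) _ = c , here refl

colouring : ∀ {n} → (ℕ → ℕ) → (ℕ → ℕ) → Vertex n → ℕ
colouring κv κu (inj₁ i) = κv (toℕ i)
colouring κv κu (inj₂ i) = κu (toℕ i)

antiprism-facialNonRepetitive : ∀ N → 1 ≤ N → (κv κu : ℕ → ℕ) →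
  (∀ s → RepetitionFreeWalk κv (λ j → (s + j) % suc N)) →
  (∀ s → RepetitionFreeWalk κu (λ j → (s + j) % suc N)) →
  (∀ r → r < suc N → κu r ≢ κv r) →
  (∀ r → r < suc N → κu r ≢ κv ((r + N) % suc N)) →
  FacialNonRepetitive {suc N} (colouring κv κu)
antiprism-facialNonRepetitive N 1≤N κv κu cycleV cycleU rung diagonal = faces
  where
  n = suc N
  φ : Vertex n → ℕ
  φ = colouring κv κu
  along : (side : Fin n → Vertex n) (κ : ℕ → ℕ) → (∀ i → φ (side i) ≡ κ (toℕ i)) →
          (q : ℕ → ℕ) → RepetitionFreeWalk κ (λ j → q j % n) → RepetitionFreeWalk φ (λ j → side (idx n (q j)))
  along side κ colour q = RepetitionFreeWalk-transfer {φ = φ} {κ = κ}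
    (λ j → trans (colour (idx n (q j))) (cong κ (toℕ-fromℕ< (m%n<n (q j) n))))
    (λ i j eq → cong side (fromℕ<-cong _ _ eq (m%n<n (q i) n) (m%n<n (q j) n)))
  colour-v : ∀ j → φ (vv j) ≡ κv (j % n)
  colour-v j = cong κv (toℕ-fromℕ< (m%n<n j n))
  colour-u : ∀ j → φ (uu j) ≡ κu (j % n)
  colour-u j = cong κu (toℕ-fromℕ< (m%n<n j n))
  recolour : ∀ {a b c d : ℕ} → a ≡ c → b ≡ d → c ≢ d → a ≢ b
  recolour a≡c b≡d = subst₂ _≢_ (sym a≡c) (sym b≡d)
  rainbowA : ∀ r → Rainbow φ (uu r) (vv r) (vv (r + N))
  rainbowA r =
      recolour (colour-u r) (colour-v r) (rung (r % n) (m%n<n r n))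
    , recolour (colour-u r) (trans (colour-v (r + N)) (cong κv (%-shift r N n))) (diagonal (r % n) (m%n<n r n))
    , recolour (trans (colour-v r) (cong κv (sym (suc[r+N]%n≡r%n r N)))) (colour-v (r + N))
               (≢-sym (cycle-adjacent N κv 1≤N cycleV (r + N)))
  rainbowB : ∀ r → Rainbow φ (vv r) (uu r) (uu (suc r))
  rainbowB r =
      recolour (colour-v r) (colour-u r) (≢-sym (rung (r % n) (m%n<n r n)))
    , recolour (trans (colour-v r) (cong κv (sym (trans (sym (%-shift (suc r) N n)) (suc[r+N]%n≡r%n r N)))))
               (colour-u (suc r)) (≢-sym (diagonal (suc r % n) (m%n<n (suc r) n)))
    , recolour (colour-u r) (colour-u (suc r)) (cycle-adjacent N κu 1≤N cycleU r)
  period : ∀ s k → (s + k * 3) % 3 ≡ (s + k * 0) % 3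
  period s k = trans ([m+kn]%n≡m%n s k 3) (cong (_% 3) (sym (trans (cong (s +_) (*-zeroʳ k)) (+-identityʳ s))))
  faces : FacialNonRepetitive φ
  faces cycV s true = along inj₁ κv (λ _ → refl) (s +_) (cycleV s)
  faces cycV s false = along inj₁ κv (λ _ → refl) (λ j → s + N * j) (cycle-backward N κv cycleV s)
  faces cycU s true = along inj₂ κu (λ _ → refl) (s +_) (cycleU s)
  faces cycU s false = along inj₂ κu (λ _ → refl) (λ j → s + N * j) (cycle-backward N κu cycleU s)
  faces (triA i) s true = triangle-repetitionFree φ _ _ _ (rainbowA (toℕ i)) (s +_) (period s 1)
  faces (triA i) s false = triangle-repetitionFree φ _ _ _ (rainbowA (toℕ i)) (λ j → s + 2 * j) (period s 2)
  faces (triB i) s true = triangle-repetitionFree φ _ _ _ (rainbowB (toℕ i)) (s +_) (period s 1)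
  faces (triB i) s false = triangle-repetitionFree φ _ _ _ (rainbowB (toℕ i)) (λ j → s + 2 * j) (period s 2)

antiprism-choosable : ∀ N → 1 ≤ N → FacialNonRepListChoosable {suc N} 7
antiprism-choosable N@(suc N′) 1≤N L uniq 7≤len =
  colouring κv κu , member , antiprism-facialNonRepetitive N 1≤N κv κu cycleV cycleU rung diagonal
  where
  n = suc N
  LV LU : ℕ → List ℕ
  LV r = L (vv r)
  LU r = L (uu r)
  a-choice = ∈-nonempty (LV 0) (≤-trans (m≤m+n 1 6) (7≤len _))
  a = proj₁ a-choice
  b-choice = ∈-nonempty (LU 0 ∖ (a ∷ [])) (proj₂ (∖-good (LU 0) (a ∷ []) 1 (uniq _) (≤-trans (m≤m+n 2 5) (7≤len _))))
  b = proj₁ b-choice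
  b∈ = ∈-∖⁻ (LU 0) (a ∷ []) (proj₂ b-choice)
  open SquareFreeChoice (squareFree-choice-indexed (λ t → LV (suc t) ∖ (a ∷ b ∷ [])) N
         (λ t → ∖-good (LV (suc t)) (a ∷ b ∷ []) 4 (uniq _) (≤-trans (n≤1+n 6) (7≤len _))))
    using () renaming (word to x; word-squareFree to x-squareFree; word-length to x-length; word-∈ to x-∈)
  κv = anchored a x
  open SquareFreeChoice (squareFree-choice-indexed (λ t → LU (suc t) ∖ (b ∷ κv (suc t) ∷ κv t ∷ [])) N
         (λ t → ∖-good (LU (suc t)) (b ∷ κv (suc t) ∷ κv t ∷ []) 4 (uniq _) (7≤len _)))
    using () renaming (word to y; word-squareFree to y-squareFree; word-length to y-length; word-∈ to y-∈)
  κu = anchored b y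
  x-avoids : ∀ t → t < N → All (nth x t ≢_) (a ∷ b ∷ [])
  x-avoids t t<N = proj₂ (∈-∖⁻ (LV (suc t)) (a ∷ b ∷ []) (x-∈ t t<N))
  y-avoids : ∀ t → t < N → All (nth y t ≢_) (b ∷ κv (suc t) ∷ κv t ∷ [])
  y-avoids t t<N = proj₂ (∈-∖⁻ (LU (suc t)) (b ∷ κv (suc t) ∷ κv t ∷ []) (y-∈ t t<N))
  cycleV : ∀ s → RepetitionFreeWalk κv (λ j → (s + j) % n)
  cycleV = cycle-repetitionFree N a x x-squareFree x-length (λ t t<N → All.head (x-avoids t t<N))
  cycleU : ∀ s → RepetitionFreeWalk κu (λ j → (s + j) % n)
  cycleU = cycle-repetitionFree N b y y-squareFree y-length (λ t t<N → All.head (y-avoids t t<N))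
  rung : ∀ r → r < n → κu r ≢ κv r
  rung zero _ = All.head (proj₂ b∈)
  rung (suc t) (s<s t<N) = All.head (All.tail (y-avoids t t<N))
  diagonal : ∀ r → r < n → κu r ≢ κv ((r + N) % n)
  diagonal zero _ b≡κvN =
    All.head (All.tail (x-avoids N′ ≤-refl)) (sym (trans b≡κvN (cong κv (m<n⇒m%n≡m {n = n} ≤-refl))))
  diagonal (suc t) (s<s t<N) y≡κv = All.head (All.tail (All.tail (y-avoids t t<N)))
    (trans y≡κv (cong κv (trans (suc[r+N]%n≡r%n t N) (m<n⇒m%n≡m (m<n⇒m<1+n t<N)))))
  member-v : ∀ r → r < n → κv r ∈ LV r
  member-v zero _ = proj₂ a-choice
  member-v (suc t) (s<s t<N) = proj₁ (∈-∖⁻ (LV (suc t)) (a ∷ b ∷ []) (x-∈ t t<N))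
  member-u : ∀ r → r < n → κu r ∈ LU r
  member-u zero _ = proj₁ b∈
  member-u (suc t) (s<s t<N) = proj₁ (∈-∖⁻ (LU (suc t)) (b ∷ κv (suc t) ∷ κv t ∷ []) (y-∈ t t<N))
  member : ∀ v → colouring κv κu v ∈ L v
  member (inj₁ i) = subst (λ j → κv (toℕ i) ∈ L (inj₁ j)) (idx-toℕ i) (member-v (toℕ i) (toℕ<n i))
  member (inj₂ i) = subst (λ j → κu (toℕ i) ∈ L (inj₂ j)) (idx-toℕ i) (member-u (toℕ i) (toℕ<n i))

theorem13 : (n : ℕ) .{{_ : NonZero n}} → 3 ≤ n → FacialNonRepListChoosable {n} 7
theorem13 (suc N) (s≤s 2≤N) = antiprism-choosable N (≤-trans (s≤s z≤n) 2≤N)
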